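{- Every connected graph $(X,E)$ with $|X|\ge2$ is represented by some network on $X$ with exactly $|E|$ roots.
   Context: In a digraph, a leaf is a vertex of indegree 1 and outdegree 0, a root is a vertex of indegree 0. A network on $X$ is a simple acyclic digraph $N$ whose underlying undirected graph is connected, whose set of leaves is $X$, in which every vertex of indegree 0 has outdegree at least 2, every vertex of outdegree 0 has indegree 1, and no vertex has both indegree and outdegree equal to 1. Leaves $x\ne y$ share an ancestor if some vertex has directed paths (possibly of length 0) to both. The shared ancestry graph $\mathcal A(N)$ has vertex set $X$, with distinct $x,y$ adjacent iff they share an ancestor in $N$. $N$ represents a graph $G$ on $X$ if $\mathcal A(N)=G$ (same edge set). -}

module Defs where

open import Data.Nat using (ℕ; zero; suc; _+_; _≥_; _<ᵇ_)
open import Data.Fin using (Fin; toℕ)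
open import Data.Bool using (Bool; true; false; if_then_else_; _∧_; _∨_)
open import Data.Product using (Σ; ∃; _×_)
open import Relation.Binary.PropositionalEquality using (_≡_; _≢_)
open import Relation.Nullary using (¬_)
open import Function using (_⇔_)
open import Function.Definitions using (Injective)

countF : ∀ {m} → (Fin m → Bool) → ℕ
countF {zero}  p = 0
countF {suc m} p = (if p Fin.zero then 1 else 0) + countF (λ i → p (Fin.suc i))

record Graph (n : ℕ) : Set where
  field
    adj     : Fin n → Fin n → Bool
    adj-sym : ∀ x y → adj x y ≡ adj y x
    adj-irr : ∀ x → adj x x ≡ false
open Graph public

edgeCount : ∀ {n} → Graph n → ℕ
edgeCount {n} G = sumF (λ x → countF (λ y → adj G x y ∧ (toℕ x <ᵇ toℕ y)))
  where
  sumF : (Fin n → ℕ) → ℕ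
  sumF = go
    where
    go : ∀ {k} → (Fin k → ℕ) → ℕ
    go {zero}  f = 0
    go {suc k} f = f Fin.zero + go (λ i → f (Fin.suc i))

data GWalk {n} (G : Graph n) : Fin n → Fin n → Set where
  here : ∀ {x} → GWalk G x x
  step : ∀ {x y z} → adj G x y ≡ true → GWalk G y z → GWalk G x z

Connected : ∀ {n} → Graph n → Set
Connected G = ∀ x y → GWalk G x y

-- Digraphs on vertex set Fin m (Boolean arc relation: no parallel arcs)

Digraph : ℕ → Set
Digraph m = Fin m → Fin m → Bool

data Path {m} (D : Digraph m) : Fin m → Fin m → Set where
  here : ∀ {a} → Path D a a
  step : ∀ {a b c} → D a b ≡ true → Path D b c → Path D a c

data UWalk {m} (D : Digraph m) : Fin m → Fin m → Set where
  here : ∀ {a} → UWalk D a a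
  step : ∀ {a b c} → (D a b ∨ D b a) ≡ true → UWalk D b c → UWalk D a c

indeg : ∀ {m} → Digraph m → Fin m → ℕ
indeg D v = countF (λ u → D u v)

outdeg : ∀ {m} → Digraph m → Fin m → ℕ
outdeg D v = countF (λ w → D v w)

isZero : ℕ → Bool
isZero zero    = true
isZero (suc _) = false

rootCount : ∀ {m} → Digraph m → ℕ
rootCount D = countF (λ v → isZero (indeg D v))

IsLeaf : ∀ {m} → Digraph m → Fin m → Set
IsLeaf D v = indeg D v ≡ 1 × outdeg D v ≡ 0

record Network (n : ℕ) : Set where
  field
    m         : ℕ
    arc       : Digraph m
    loopless  : ∀ v → arc v v ≡ false
    acyclic   : ∀ a b → arc a b ≡ true → ¬ Path arc b a
    connected : ∀ a b → UWalk arc a b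
    leaf      : Fin n → Fin m
    leaf-inj  : Injective _≡_ _≡_ leaf
    leaves    : ∀ v → IsLeaf arc v ⇔ (∃ λ x → leaf x ≡ v)
    root-out  : ∀ v → indeg arc v ≡ 0 → outdeg arc v ≥ 2
    sink-in   : ∀ v → outdeg arc v ≡ 0 → indeg arc v ≡ 1
    no-deg11  : ∀ v → ¬ (indeg arc v ≡ 1 × outdeg arc v ≡ 1)
open Network public

roots : ∀ {n} → Network n → ℕ
roots N = rootCount (arc N)

ShareAncestor : ∀ {n} → Network n → Fin n → Fin n → Set
ShareAncestor N x y =
  ∃ λ w → Path (arc N) w (leaf N x) × Path (arc N) w (leaf N y)

Represents : ∀ {n} → Network n → Graph n → Set
Represents N G = ∀ x y → x ≢ y → (adj G x y ≡ true ⇔ ShareAncestor N x y)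

{-# OPTIONS --safe #-}
module Submission where

-- The network has a leaf for every x and a vertex (a , b) for every ordered
-- pair.  The diagonal vertex (x , x) is the only parent of leaf x.  For an
-- edge ab both (a , b) and (b , a) point to (a , a) and (b , b), and the one
-- with a < b is a root above the other, so the roots are exactly the edges.
-- A non-adjacent pair (c , d) is a dummy vertex below (c , ν c) and
-- (ν c , c), for a fixed neighbour ν c of c, and above (c , c).  The leaves
-- below (a , b) are {a , b} for an edge and {a} otherwise, so two leaves
-- share an ancestor iff they are adjacent.  The dummies make the vertex set
-- X ⊎ X × X, and the neighbours ν make every inner vertex have indegree or
-- outdegree at least 2.

open import Defs
open import Data.Nat using (ℕ; _≥_)
open import Data.Product using (Σ; _×_)
open import Relation.Binary.PropositionalEquality using (_≡_)

open import Data.Bool using (Bool; true; false; if_then_else_; _∧_; _∨_)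
import Data.Bool as Bool
open import Data.Bool.Properties using (¬-not; ∨-zeroʳ; ∨-comm)
open import Data.Empty using (⊥; ⊥-elim)
open import Data.Fin using (Fin; toℕ; splitAt; remQuot; quotRem; punchIn; _<_; _≟_; _<?_)
open import Data.Fin.Properties
  using (+↔⊎; *↔×; suc-injective; 0≢1+n; punchInᵢ≢i; <-asym; <-cmp; ≤∧≢⇒<)
open import Data.Nat using (zero; suc; _+_; _*_; _≤_; z≤n; s≤s; _<ᵇ_)
import Data.Nat as ℕ
open import Data.Nat.Properties
  using (+-assoc; m≤n+m; ≤-refl; ≤-trans; <⇒≤; <-≤-trans; <-irrefl; ≮⇒≥; <ᵇ-reflects-<; +-0-monoid)
open import Data.Product using (∃; _,_; proj₁; proj₂)
import Data.Product as Product
open import Data.Sum using (_⊎_; inj₁; inj₂)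
import Data.Sum as Sum
open import Data.Sum.Function.Propositional using (_⊎-↔_)
open import Data.Sum.Properties using (inj₁-injective; inj₂-injective)
open import Function using (_∘_; _⇔_; mk⇔)
open import Function.Bundles using (_↔_; Inverse)
open import Function.Properties.Inverse using (↔-refl; ↔-trans)
open import Relation.Binary.Definitions using (tri<; tri≈; tri>)
open import Relation.Binary.PropositionalEquality
  using (_≢_; refl; sym; trans; cong; subst; subst₂; module ≡-Reasoning)
open import Relation.Nullary using (¬_; Dec; yes; no; does; proof; map′; _×-dec_; _⊎-dec_; ¬?)
open import Relation.Nullary.Decidable using (dec-true)
open import Relation.Nullary.Reflects using (Reflects; ofʸ; ofⁿ; invert)

open import Algebra.Properties.Monoid.Sum +-0-monoid using (sum)

-- Counting

countF-cong : ∀ {m} {p q : Fin m → Bool} → (∀ i → p i ≡ q i) → countF p ≡ countF q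
countF-cong {zero}  p≗q = refl
countF-cong {suc m} p≗q rewrite p≗q Fin.zero = cong (_ +_) (countF-cong (p≗q ∘ Fin.suc))

countF-none : ∀ {m} (p : Fin m → Bool) → (∀ i → p i ≡ false) → countF p ≡ 0
countF-none {zero}  p none = refl
countF-none {suc m} p none rewrite none Fin.zero = countF-none (p ∘ Fin.suc) (none ∘ Fin.suc)

countF-≥1 : ∀ {m} (p : Fin m → Bool) i → p i ≡ true → 1 ≤ countF p
countF-≥1 p Fin.zero    pi rewrite pi = s≤s z≤n
countF-≥1 p (Fin.suc i) pi = ≤-trans (countF-≥1 (p ∘ Fin.suc) i pi) (m≤n+m _ _)

countF-≥2 : ∀ {m} (p : Fin m → Bool) i j → p i ≡ true → p j ≡ true → i ≢ j → 2 ≤ countF p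
countF-≥2 p Fin.zero    Fin.zero    pi pj i≢j = ⊥-elim (i≢j refl)
countF-≥2 p Fin.zero    (Fin.suc j) pi pj i≢j rewrite pi = s≤s (countF-≥1 (p ∘ Fin.suc) j pj)
countF-≥2 p (Fin.suc i) Fin.zero    pi pj i≢j rewrite pj = s≤s (countF-≥1 (p ∘ Fin.suc) i pi)
countF-≥2 p (Fin.suc i) (Fin.suc j) pi pj i≢j =
  ≤-trans (countF-≥2 (p ∘ Fin.suc) i j pi pj (i≢j ∘ cong Fin.suc)) (m≤n+m _ _)

countF-unique : ∀ {m} (p : Fin m → Bool) i → p i ≡ true → (∀ j → p j ≡ true → j ≡ i) →
                countF p ≡ 1
countF-unique p Fin.zero pi unique rewrite pi =
  cong suc (countF-none (p ∘ Fin.suc) λ j → ¬-not λ pj → 0≢1+n (sym (unique (Fin.suc j) pj)))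
countF-unique p (Fin.suc i) pi unique rewrite ¬-not (λ p0 → 0≢1+n (unique Fin.zero p0)) =
  countF-unique (p ∘ Fin.suc) i pi (λ j pj → suc-injective (unique (Fin.suc j) pj))

countF-splitAt : ∀ a {b} (f : Fin a ⊎ Fin b → Bool) →
                 countF (f ∘ splitAt a) ≡ countF (f ∘ inj₁) + countF (f ∘ inj₂)
countF-splitAt zero    f = refl
countF-splitAt (suc a) f =
  trans (cong (first +_) (countF-splitAt a (f ∘ Sum.map₁ Fin.suc))) (sym (+-assoc first _ _))
  where
  first : ℕ
  first = if f (inj₁ Fin.zero) then 1 else 0

countF-remQuot : ∀ a {b} (f : Fin a × Fin b → Bool) →
                 countF (f ∘ remQuot b) ≡ sum (λ x → countF (λ y → f (x , y)))
countF-remQuot zero    f = refl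
countF-remQuot (suc a) {b} f = begin
  countF (f ∘ remQuot b)
    ≡⟨ countF-splitAt b (f ∘ Product.swap ∘ Sum.[ (_, Fin.zero) , Product.map₂ Fin.suc ∘ quotRem {a} b ]′) ⟩
  countF (λ y → f (Fin.zero , y)) + countF (f ∘ Product.map₁ Fin.suc ∘ remQuot b)
    ≡⟨ cong (countF (λ y → f (Fin.zero , y)) +_) (countF-remQuot a (f ∘ Product.map₁ Fin.suc)) ⟩
  sum (λ x → countF (λ y → f (x , y))) ∎
  where open ≡-Reasoning

module Enumerated {V : Set} {m : ℕ} (enumeration : Fin m ↔ V) where

  open Inverse enumeration public using (strictlyInverseˡ; strictlyInverseʳ)
    renaming (to to element; from to index)

  count : (V → Bool) → ℕ
  count q = countF (q ∘ element)

  index-injective : ∀ {u v} → index u ≡ index v → u ≡ v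
  index-injective {u} {v} eq = trans (sym (strictlyInverseˡ u)) (trans (cong element eq) (strictlyInverseˡ v))

  count-none : ∀ (q : V → Bool) → (∀ u → q u ≡ false) → count q ≡ 0
  count-none q none = countF-none (q ∘ element) (none ∘ element)

  count-≥1 : ∀ (q : V → Bool) u → q u ≡ true → 1 ≤ count q
  count-≥1 q u qu = countF-≥1 (q ∘ element) (index u) (trans (cong q (strictlyInverseˡ u)) qu)

  count-≥2 : ∀ (q : V → Bool) u v → q u ≡ true → q v ≡ true → u ≢ v → 2 ≤ count q
  count-≥2 q u v qu qv u≢v =
    countF-≥2 (q ∘ element) (index u) (index v)
      (trans (cong q (strictlyInverseˡ u)) qu) (trans (cong q (strictlyInverseˡ v)) qv)
      (u≢v ∘ index-injective)

  count-unique : ∀ (q : V → Bool) u → q u ≡ true → (∀ v → q v ≡ true → v ≡ u) → count q ≡ 1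
  count-unique q u qu unique =
    countF-unique (q ∘ element) (index u) (trans (cong q (strictlyInverseˡ u)) qu)
      (λ i qi → trans (sym (strictlyInverseʳ i)) (cong index (unique (element i) qi)))

-- Graphs

upperDegree : ∀ {n} → Graph n → Fin n → ℕ
upperDegree G x = countF (λ y → adj G x y ∧ (toℕ x <ᵇ toℕ y))

edgelessGraph : ∀ n → Graph n
edgelessGraph n = record { adj = λ _ _ → false ; adj-sym = λ _ _ → refl ; adj-irr = λ _ → refl }

-- edgeCount sums with a helper local to its where-block.  Abstracting the
-- summand lets unification solve edgeCountSum as that helper, which ignores
-- its graph argument; so the recursion may pass through edgeless graphs.
private
  mutual
    edgeCountSum : ∀ {n} → Graph n → (Fin n → ℕ) → ℕ
    edgeCountSum = _

    edgeCount-edgeCountSum : ∀ {n} (G : Graph n) → edgeCountSum G (upperDegree G) ≡ edgeCount G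
    edgeCount-edgeCountSum G with upperDegree G
    ... | d = refl

  edgeCountSum≡sum : ∀ {n} (G : Graph n) (f : Fin n → ℕ) → edgeCountSum G f ≡ sum f
  edgeCountSum≡sum {zero}  G f = refl
  edgeCountSum≡sum {suc n} G f = cong (f Fin.zero +_) (edgeCountSum≡sum (edgelessGraph n) (f ∘ Fin.suc))

edgeCount≡sum-upperDegree : ∀ {n} (G : Graph n) → edgeCount G ≡ sum (upperDegree G)
edgeCount≡sum-upperDegree G = trans (sym (edgeCount-edgeCountSum G)) (edgeCountSum≡sum G (upperDegree G))

module _ {n} (G : Graph n) where

  adj-sym-true : ∀ {a b} → adj G a b ≡ true → adj G b a ≡ true
  adj-sym-true {a} {b} ab = trans (adj-sym G b a) ab

  adj⇒≢ : ∀ {a b} → adj G a b ≡ true → a ≢ b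
  adj⇒≢ {a} ab refl with () ← trans (sym ab) (adj-irr G a)

walk-first-step : ∀ {n} {G : Graph n} {x y} → GWalk G x y → x ≢ y → ∃ λ z → adj G x z ≡ true
walk-first-step here        x≢x = ⊥-elim (x≢x refl)
walk-first-step (step xz _) _   = _ , xz

connected⇒neighbour : ∀ {n} {G : Graph n} → n ≥ 2 → Connected G → ∀ x → ∃ λ y → adj G x y ≡ true
connected⇒neighbour {suc (suc k)} (s≤s (s≤s z≤n)) connected x =
  walk-first-step (connected x (punchIn x Fin.zero)) (punchInᵢ≢i x Fin.zero ∘ sym)

-- Digraphs

module _ {m} {D : Digraph m} where

  UWalk-forward : ∀ {a b} → D a b ≡ true → UWalk D a b
  UWalk-forward {a} {b} ab = step (cong (_∨ D b a) ab) here

  UWalk-backward : ∀ {a b} → D b a ≡ true → UWalk D a b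
  UWalk-backward {a} {b} ba = step (trans (cong (D a b ∨_) ba) (∨-zeroʳ (D a b))) here

  infixr 5 _++ᵘ_
  _++ᵘ_ : ∀ {a b c} → UWalk D a b → UWalk D b c → UWalk D a c
  here        ++ᵘ q = q
  step ab p   ++ᵘ q = step ab (p ++ᵘ q)

  UWalk-sym : ∀ {a b} → UWalk D a b → UWalk D b a
  UWalk-sym here = here
  UWalk-sym {a} (step {b = b} ab p) =
    UWalk-sym p ++ᵘ step (trans (∨-comm (D b a) (D a b)) ab) here

module _ {m} (D : Digraph m) (height : Fin m → ℕ)
         (height-arc : ∀ {a b} → D a b ≡ true → height b ℕ.< height a) where

  height-path : ∀ {a b} → Path D a b → height b ≤ height a
  height-path here        = ≤-refl
  height-path (step ab p) = ≤-trans (height-path p) (<⇒≤ (height-arc ab))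

  height⇒acyclic : ∀ a b → D a b ≡ true → ¬ Path D b a
  height⇒acyclic a b ab ba = <-irrefl refl (<-≤-trans (height-arc ab) (height-path ba))

  height⇒loopless : ∀ a → D a a ≡ false
  height⇒loopless a = ¬-not λ aa → height⇒acyclic a a aa here

-- The network

module Construction {n} (G : Graph n) (neighbour : ∀ x → ∃ λ y → adj G x y ≡ true) where

  ν : Fin n → Fin n
  ν x = proj₁ (neighbour x)

  Edge : Fin n → Fin n → Set
  Edge a b = adj G a b ≡ true

  Nonadjacent : Fin n → Fin n → Set
  Nonadjacent a b = a ≢ b × adj G a b ≡ false

  Vertex : Set
  Vertex = Fin n ⊎ (Fin n × Fin n)

  pattern leafᵛ x = inj₁ x
  pattern pair a b = inj₂ (a , b)

  data Arc : Vertex → Vertex → Set where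
    root→twin   : ∀ {a b} → Edge a b → a < b → Arc (pair a b) (pair b a)
    edge→diag   : ∀ {a b c} → Edge a b → c ≡ a ⊎ c ≡ b → Arc (pair a b) (pair c c)
    hubˡ→dummy  : ∀ {c d} → Nonadjacent c d → Arc (pair c (ν c)) (pair c d)
    hubʳ→dummy  : ∀ {c d} → Nonadjacent c d → Arc (pair (ν c) c) (pair c d)
    dummy→diag  : ∀ {a b} → Nonadjacent a b → Arc (pair a b) (pair a a)
    diag→leaf   : ∀ {x} → Arc (pair x x) (leafᵛ x)

  ArcSpec : Vertex → Vertex → Set
  ArcSpec (leafᵛ _)  _          = ⊥
  ArcSpec (pair a b) (leafᵛ x)  = a ≡ x × b ≡ x
  ArcSpec (pair a b) (pair c d) =
      (Edge a b × a < b × c ≡ b × d ≡ a)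
    ⊎ (Edge a b × c ≡ d × (c ≡ a ⊎ c ≡ b))
    ⊎ (Nonadjacent c d × a ≡ c × b ≡ ν c)
    ⊎ (Nonadjacent c d × b ≡ c × a ≡ ν c)
    ⊎ (Nonadjacent a b × c ≡ d × c ≡ a)

  spec→arc : ∀ {u v} → ArcSpec u v → Arc u v
  spec→arc {pair a b} {leafᵛ x}  (refl , refl)                            = diag→leaf
  spec→arc {pair a b} {pair c d} (inj₁ (ab , a<b , refl , refl))          = root→twin ab a<b
  spec→arc {pair a b} {pair c d} (inj₂ (inj₁ (ab , refl , c∈ab)))         = edge→diag ab c∈ab
  spec→arc {pair a b} {pair c d} (inj₂ (inj₂ (inj₁ (cd , refl , refl))))  = hubˡ→dummy cd
  spec→arc {pair a b} {pair c d} (inj₂ (inj₂ (inj₂ (inj₁ (cd , refl , refl))))) = hubʳ→dummy cd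
  spec→arc {pair a b} {pair c d} (inj₂ (inj₂ (inj₂ (inj₂ (ab , refl , refl))))) = dummy→diag ab

  arc→spec : ∀ {u v} → Arc u v → ArcSpec u v
  arc→spec (root→twin ab a<b) = inj₁ (ab , a<b , refl , refl)
  arc→spec (edge→diag ab c∈ab) = inj₂ (inj₁ (ab , refl , c∈ab))
  arc→spec (hubˡ→dummy cd)     = inj₂ (inj₂ (inj₁ (cd , refl , refl)))
  arc→spec (hubʳ→dummy cd)     = inj₂ (inj₂ (inj₂ (inj₁ (cd , refl , refl))))
  arc→spec (dummy→diag ab)     = inj₂ (inj₂ (inj₂ (inj₂ (ab , refl , refl))))
  arc→spec diag→leaf           = refl , refl

  edge? : ∀ a b → Dec (Edge a b)
  edge? a b = adj G a b Bool.≟ true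

  nonadjacent? : ∀ a b → Dec (Nonadjacent a b)
  nonadjacent? a b = ¬? (a ≟ b) ×-dec (adj G a b Bool.≟ false)

  spec? : ∀ u v → Dec (ArcSpec u v)
  spec? (leafᵛ _)  _          = no λ ()
  spec? (pair a b) (leafᵛ x)  = (a ≟ x) ×-dec (b ≟ x)
  spec? (pair a b) (pair c d) =
        (edge? a b ×-dec a <? b ×-dec c ≟ b ×-dec d ≟ a)
    ⊎-dec (edge? a b ×-dec c ≟ d ×-dec (c ≟ a ⊎-dec c ≟ b))
    ⊎-dec (nonadjacent? c d ×-dec a ≟ c ×-dec b ≟ ν c)
    ⊎-dec (nonadjacent? c d ×-dec b ≟ c ×-dec a ≟ ν c)
    ⊎-dec (nonadjacent? a b ×-dec c ≟ d ×-dec c ≟ a)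

  arc? : ∀ u v → Dec (Arc u v)
  arc? u v = map′ spec→arc arc→spec (spec? u v)

  arcᴮ : Vertex → Vertex → Bool
  arcᴮ u v = does (arc? u v)

  arcᴮ-sound : ∀ {u v} → arcᴮ u v ≡ true → Arc u v
  arcᴮ-sound {u} {v} uv = invert (subst (Reflects (Arc u v)) uv (proof (arc? u v)))

  arcᴮ-complete : ∀ {u v} → Arc u v → arcᴮ u v ≡ true
  arcᴮ-complete {u} {v} = dec-true (arc? u v)

  ν-edge : ∀ x → Edge x (ν x)
  ν-edge x = proj₂ (neighbour x)

  ν-edge⁻¹ : ∀ x → Edge (ν x) x
  ν-edge⁻¹ x = adj-sym-true G (ν-edge x)

  height : Vertex → ℕ
  height (leafᵛ _)  = 0
  height (pair a b) with a ≟ b | adj G a b | a <? b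
  ... | yes _ | _     | _     = 1
  ... | no _  | false | _     = 2
  ... | no _  | true  | no _  = 3
  ... | no _  | true  | yes _ = 4

  height-diag : ∀ a → height (pair a a) ≡ 1
  height-diag a with a ≟ a
  ... | yes _   = refl
  ... | no a≢a = ⊥-elim (a≢a refl)

  height-nonadjacent : ∀ {a b} → Nonadjacent a b → height (pair a b) ≡ 2
  height-nonadjacent {a} {b} (a≢b , ab) with a ≟ b
  ... | yes a≡b = ⊥-elim (a≢b a≡b)
  ... | no _ rewrite ab = refl

  height-root : ∀ {a b} → Edge a b → a < b → height (pair a b) ≡ 4
  height-root {a} {b} ab a<b with a ≟ b | a <? b
  ... | yes a≡b | _       = ⊥-elim (adj⇒≢ G ab a≡b)
  ... | no _    | no a≮b = ⊥-elim (a≮b a<b)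
  ... | no _    | yes _ rewrite ab = refl

  height-twin : ∀ {a b} → Edge a b → b < a → height (pair a b) ≡ 3
  height-twin {a} {b} ab b<a with a ≟ b | a <? b
  ... | yes a≡b | _       = ⊥-elim (adj⇒≢ G ab a≡b)
  ... | no _    | yes a<b = ⊥-elim (<-asym a<b b<a)
  ... | no _    | no _ rewrite ab = refl

  height-edge : ∀ {a b} → Edge a b → 3 ≤ height (pair a b)
  height-edge {a} {b} ab with <-cmp a b
  ... | tri< a<b _ _   = subst (3 ≤_) (sym (height-root ab a<b)) (s≤s (s≤s (s≤s z≤n)))
  ... | tri≈ _ a≡b _   = ⊥-elim (adj⇒≢ G ab a≡b)
  ... | tri> _ _ b<a   = subst (3 ≤_) (sym (height-twin ab b<a)) ≤-refl

  height-arc : ∀ {u v} → Arc u v → height v ℕ.< height u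
  height-arc (root→twin ab a<b)
    rewrite height-twin (adj-sym-true G ab) a<b | height-root ab a<b = ≤-refl
  height-arc (edge→diag {c = c} ab _) rewrite height-diag c = <-≤-trans (s≤s (s≤s z≤n)) (height-edge ab)
  height-arc (hubˡ→dummy {c} cd) rewrite height-nonadjacent cd = height-edge (ν-edge c)
  height-arc (hubʳ→dummy {c} cd) rewrite height-nonadjacent cd = height-edge (ν-edge⁻¹ c)
  height-arc (dummy→diag {a} ab) rewrite height-nonadjacent ab | height-diag a = ≤-refl
  height-arc (diag→leaf {x})     rewrite height-diag x = ≤-refl

  diag-child : ∀ {a b} → a ≢ b → Arc (pair a b) (pair a a)
  diag-child {a} {b} a≢b with adj G a b in ab
  ... | true  = edge→diag ab (inj₁ refl)
  ... | false = dummy→diag (a≢b , ab)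

  some-child : ∀ a b → ∃ (Arc (pair a b))
  some-child a b with a ≟ b
  ... | yes refl = leafᵛ a , diag→leaf
  ... | no a≢b   = pair a a , diag-child a≢b

  diag-only-parent : ∀ {u x} → Arc u (leafᵛ x) → u ≡ pair x x
  diag-only-parent diag→leaf = refl

  nonedge-parents : ∀ {a b} → adj G a b ≡ false →
                    Arc (pair a (ν a)) (pair a b) × Arc (pair (ν a) a) (pair a b)
  nonedge-parents {a} {b} ab with a ≟ b
  ... | yes refl = edge→diag (ν-edge a) (inj₁ refl) , edge→diag (ν-edge⁻¹ a) (inj₂ refl)
  ... | no a≢b   = hubˡ→dummy (a≢b , ab) , hubʳ→dummy (a≢b , ab)

  twin-parent : ∀ {a b} → Edge a b → ¬ a < b → Arc (pair b a) (pair a b)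
  twin-parent ab a≮b = root→twin (adj-sym-true G ab) (≤∧≢⇒< (≮⇒≥ a≮b) (adj⇒≢ G ab ∘ sym))

  root-parentless : ∀ {u a b} → Edge a b → a < b → ¬ Arc u (pair a b)
  root-parentless ab a<b (root→twin _ b<a)  = <-asym a<b b<a
  root-parentless ab a<b (edge→diag _ _)    = adj⇒≢ G ab refl
  root-parentless ab a<b (hubˡ→dummy (_ , ab′)) with () ← trans (sym ab) ab′
  root-parentless ab a<b (hubʳ→dummy (_ , ab′)) with () ← trans (sym ab) ab′
  root-parentless ab a<b (dummy→diag _)     = adj⇒≢ G ab refl

  vertices : Fin (n + n * n) ↔ Vertex
  vertices = ↔-trans +↔⊎ (↔-refl ⊎-↔ *↔×)

  open Enumerated vertices

  arcᶠ : Digraph (n + n * n)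
  arcᶠ i j = arcᴮ (element i) (element j)

  arc-index : ∀ {u v} → Arc u v → arcᶠ (index u) (index v) ≡ true
  arc-index {u} {v} uv =
    subst₂ (λ s t → arcᴮ s t ≡ true) (sym (strictlyInverseˡ u)) (sym (strictlyInverseˡ v)) (arcᴮ-complete uv)

  indegᵛ outdegᵛ : Vertex → ℕ
  indegᵛ v = count (λ u → arcᴮ u v)
  outdegᵛ u = count (arcᴮ u)

  leaf-indeg : ∀ x → indegᵛ (leafᵛ x) ≡ 1
  leaf-indeg x = count-unique (λ u → arcᴮ u (leafᵛ x)) (pair x x) (arcᴮ-complete (diag→leaf {x})) (λ u ux → diag-only-parent (arcᴮ-sound ux))

  leaf-outdeg : ∀ x → outdegᵛ (leafᵛ x) ≡ 0
  leaf-outdeg x = count-none (arcᴮ (leafᵛ x)) λ _ → refl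

  pair-outdeg≥1 : ∀ a b → 1 ≤ outdegᵛ (pair a b)
  pair-outdeg≥1 a b = count-≥1 (arcᴮ (pair a b)) (proj₁ (some-child a b)) (arcᴮ-complete (proj₂ (some-child a b)))

  nonedge-indeg≥2 : ∀ {a b} → adj G a b ≡ false → 2 ≤ indegᵛ (pair a b)
  nonedge-indeg≥2 {a} {b} ab = count-≥2 (λ u → arcᴮ u (pair a b)) (pair a (ν a)) (pair (ν a) a) (arcᴮ-complete hubˡ) (arcᴮ-complete hubʳ)
    (λ eq → adj⇒≢ G (ν-edge a) (cong proj₁ (inj₂-injective eq)))
    where hubˡ = proj₁ (nonedge-parents ab)
          hubʳ = proj₂ (nonedge-parents ab)

  edge-outdeg≥2 : ∀ {a b} → Edge a b → 2 ≤ outdegᵛ (pair a b)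
  edge-outdeg≥2 {a} {b} ab = count-≥2 (arcᴮ (pair a b)) (pair a a) (pair b b) (arcᴮ-complete (edge→diag ab (inj₁ refl)))
    (arcᴮ-complete (edge→diag ab (inj₂ refl))) (λ { refl → adj⇒≢ G ab refl })

  root-indeg : ∀ {a b} → Edge a b → a < b → indegᵛ (pair a b) ≡ 0
  root-indeg {a} {b} ab a<b = count-none (λ u → arcᴮ u (pair a b)) λ u → ¬-not (root-parentless ab a<b ∘ arcᴮ-sound {u})

  twin-indeg≥1 : ∀ {a b} → Edge a b → ¬ a < b → 1 ≤ indegᵛ (pair a b)
  twin-indeg≥1 {a} {b} ab a≮b = count-≥1 (λ u → arcᴮ u (pair a b)) (pair b a) (arcᴮ-complete (twin-parent ab a≮b))

  pair-branching : ∀ a b → 2 ≤ indegᵛ (pair a b) ⊎ 2 ≤ outdegᵛ (pair a b)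
  pair-branching a b with adj G a b in ab
  ... | false = inj₁ (nonedge-indeg≥2 ab)
  ... | true  = inj₂ (edge-outdeg≥2 ab)

  isRootᴮ : Vertex → Bool
  isRootᴮ (leafᵛ _)  = false
  isRootᴮ (pair a b) = adj G a b ∧ (toℕ a <ᵇ toℕ b)

  isZero-≥1 : ∀ {k} → 1 ≤ k → isZero k ≡ false
  isZero-≥1 (s≤s _) = refl

  isZero-indeg : ∀ u → isZero (indegᵛ u) ≡ isRootᴮ u
  isZero-indeg (leafᵛ x) rewrite leaf-indeg x = refl
  isZero-indeg (pair a b) with adj G a b in ab | toℕ a <ᵇ toℕ b | <ᵇ-reflects-< (toℕ a) (toℕ b)
  ... | false | _ | _          = isZero-≥1 (<⇒≤ (nonedge-indeg≥2 ab))
  ... | true  | _ | ofʸ a<b    = cong isZero (root-indeg ab a<b)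
  ... | true  | _ | ofⁿ a≮b    = isZero-≥1 (twin-indeg≥1 ab a≮b)

  indeg≡0⇒outdeg≥2 : ∀ u → indegᵛ u ≡ 0 → 2 ≤ outdegᵛ u
  indeg≡0⇒outdeg≥2 (leafᵛ x) in0 with () ← trans (sym (leaf-indeg x)) in0
  indeg≡0⇒outdeg≥2 (pair a b) in0 with pair-branching a b
  ... | inj₁ in≥2  with () ← subst (2 ≤_) in0 in≥2
  ... | inj₂ out≥2 = out≥2

  outdeg≡0⇒leaf : ∀ u → outdegᵛ u ≡ 0 → ∃ λ x → u ≡ leafᵛ x
  outdeg≡0⇒leaf (leafᵛ x)  _    = x , refl
  outdeg≡0⇒leaf (pair a b) out0 with () ← subst (1 ≤_) out0 (pair-outdeg≥1 a b)

  not-indeg1-outdeg1 : ∀ u → ¬ (indegᵛ u ≡ 1 × outdegᵛ u ≡ 1)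
  not-indeg1-outdeg1 (leafᵛ x) (_ , out1) with () ← trans (sym (leaf-outdeg x)) out1
  not-indeg1-outdeg1 (pair a b) (in1 , out1) with pair-branching a b
  ... | inj₁ in≥2  with s≤s () ← subst (2 ≤_) in1 in≥2
  ... | inj₂ out≥2 with s≤s () ← subst (2 ≤_) out1 out≥2

  arcᶠ-height : ∀ {i j} → arcᶠ i j ≡ true → height (element j) ℕ.< height (element i)
  arcᶠ-height {i} {j} ij = height-arc (arcᴮ-sound {element i} {element j} ij)

  leafIndex : Fin n → Fin (n + n * n)
  leafIndex x = index (leafᵛ x)

  leafIndex-isLeaf : ∀ v → IsLeaf arcᶠ v ⇔ (∃ λ x → leafIndex x ≡ v)
  leafIndex-isLeaf v = mk⇔ isLeaf⇒leafIndex leafIndex⇒isLeaf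
    where
    isLeaf⇒leafIndex : IsLeaf arcᶠ v → ∃ λ x → leafIndex x ≡ v
    isLeaf⇒leafIndex (_ , out0) with outdeg≡0⇒leaf (element v) out0
    ... | x , v≡x = x , trans (cong index (sym v≡x)) (strictlyInverseʳ v)
    leafIndex⇒isLeaf : (∃ λ x → leafIndex x ≡ v) → IsLeaf arcᶠ v
    leafIndex⇒isLeaf (x , refl) = subst (λ u → indegᵛ u ≡ 1) (sym (strictlyInverseˡ (leafᵛ x))) (leaf-indeg x)
                                , subst (λ u → outdegᵛ u ≡ 0) (sym (strictlyInverseˡ (leafᵛ x))) (leaf-outdeg x)

  home : Vertex → Fin n
  home (leafᵛ x)  = x
  home (pair a b) = a

  arc-walk : ∀ {u v} → Arc u v → UWalk arcᶠ (index u) (index v)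
  arc-walk uv = UWalk-forward (arc-index uv)

  arc-walk⁻¹ : ∀ {u v} → Arc v u → UWalk arcᶠ (index u) (index v)
  arc-walk⁻¹ vu = UWalk-backward (arc-index vu)

  walk-home : ∀ u → UWalk arcᶠ (index u) (leafIndex (home u))
  walk-home (leafᵛ x) = here
  walk-home (pair a b) with a ≟ b
  ... | yes refl = arc-walk diag→leaf
  ... | no a≢b   = arc-walk (diag-child a≢b) ++ᵘ arc-walk diag→leaf

  edge-walk : ∀ {x y} → Edge x y → UWalk arcᶠ (leafIndex x) (leafIndex y)
  edge-walk xy = arc-walk⁻¹ diag→leaf ++ᵘ arc-walk⁻¹ (edge→diag xy (inj₁ refl))
              ++ᵘ arc-walk (edge→diag xy (inj₂ refl)) ++ᵘ arc-walk diag→leaf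

  graph-walk : ∀ {x y} → GWalk G x y → UWalk arcᶠ (leafIndex x) (leafIndex y)
  graph-walk here        = here
  graph-walk (step xy w) = edge-walk xy ++ᵘ graph-walk w

  uwalk-connected : Connected G → ∀ i j → UWalk arcᶠ i j
  uwalk-connected connected i j =
    subst₂ (UWalk arcᶠ) (strictlyInverseʳ i) (strictlyInverseʳ j)
      (walk-home (element i)
        ++ᵘ graph-walk (connected (home (element i)) (home (element j)))
        ++ᵘ UWalk-sym (walk-home (element j)))

  network : Connected G → Network n
  network connected = record
    { m         = n + n * n
    ; arc       = arcᶠ
    ; loopless  = height⇒loopless arcᶠ (height ∘ element) arcᶠ-height
    ; acyclic   = height⇒acyclic arcᶠ (height ∘ element) arcᶠ-height
    ; connected = uwalk-connected connected
    ; leaf      = leafIndex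
    ; leaf-inj  = inj₁-injective ∘ index-injective
    ; leaves    = leafIndex-isLeaf
    ; root-out  = indeg≡0⇒outdeg≥2 ∘ element
    ; sink-in   = λ v out0 → subst (λ u → indegᵛ u ≡ 1) (sym (proj₂ (outdeg≡0⇒leaf (element v) out0))) (leaf-indeg _)
    ; no-deg11  = not-indeg1-outdeg1 ∘ element
    }

  LeafBelow : Vertex → Fin n → Set
  LeafBelow (leafᵛ x)  z = z ≡ x
  LeafBelow (pair a b) z = z ≡ a ⊎ (Edge a b × z ≡ b)

  LeafBelow-arc : ∀ {u v z} → Arc u v → LeafBelow v z → LeafBelow u z
  LeafBelow-arc (root→twin ab _)          (inj₁ z≡b)       = inj₂ (ab , z≡b)
  LeafBelow-arc (root→twin _ _)           (inj₂ (_ , z≡a)) = inj₁ z≡a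
  LeafBelow-arc (edge→diag _ (inj₁ refl)) (inj₁ z≡a)       = inj₁ z≡a
  LeafBelow-arc (edge→diag _ (inj₁ refl)) (inj₂ (_ , z≡a)) = inj₁ z≡a
  LeafBelow-arc (edge→diag ab (inj₂ refl)) (inj₁ z≡b)       = inj₂ (ab , z≡b)
  LeafBelow-arc (edge→diag ab (inj₂ refl)) (inj₂ (_ , z≡b)) = inj₂ (ab , z≡b)
  LeafBelow-arc (hubˡ→dummy _)            (inj₁ z≡c)       = inj₁ z≡c
  LeafBelow-arc (hubˡ→dummy (_ , cd′))    (inj₂ (cd , _)) with () ← trans (sym cd) cd′
  LeafBelow-arc (hubʳ→dummy {c} _)        (inj₁ z≡c)       = inj₂ (ν-edge⁻¹ c , z≡c)
  LeafBelow-arc (hubʳ→dummy (_ , cd′))    (inj₂ (cd , _)) with () ← trans (sym cd) cd′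
  LeafBelow-arc (dummy→diag _)            (inj₁ z≡a)       = inj₁ z≡a
  LeafBelow-arc (dummy→diag _)            (inj₂ (_ , z≡a)) = inj₁ z≡a
  LeafBelow-arc diag→leaf                 z≡x              = inj₁ z≡x

  LeafBelow-path : ∀ {i j z} → Path arcᶠ i j → LeafBelow (element j) z → LeafBelow (element i) z
  LeafBelow-path here        below = below
  LeafBelow-path (step {a = i} {b = k} ik p) below =
    LeafBelow-arc (arcᴮ-sound {element i} {element k} ik) (LeafBelow-path p below)

  LeafBelow⇒adjacent : ∀ {u x y} → LeafBelow u x → LeafBelow u y → x ≢ y → Edge x y
  LeafBelow⇒adjacent {leafᵛ _}  refl               refl               x≢y = ⊥-elim (x≢y refl)
  LeafBelow⇒adjacent {pair _ _} (inj₁ refl)        (inj₁ refl)        x≢y = ⊥-elim (x≢y refl)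
  LeafBelow⇒adjacent {pair _ _} (inj₁ refl)        (inj₂ (ab , refl)) _   = ab
  LeafBelow⇒adjacent {pair _ _} (inj₂ (ab , refl)) (inj₁ refl)        _   = adj-sym-true G ab
  LeafBelow⇒adjacent {pair _ _} (inj₂ (_ , refl))  (inj₂ (_ , refl))  x≢y = ⊥-elim (x≢y refl)

  LeafBelow-leafIndex : ∀ x → LeafBelow (element (leafIndex x)) x
  LeafBelow-leafIndex x = subst (λ u → LeafBelow u x) (sym (strictlyInverseˡ (leafᵛ x))) refl

  represents : (connected : Connected G) → Represents (network connected) G
  represents connected x y x≢y = mk⇔ edge⇒shared shared⇒edge
    where
    edge⇒shared : Edge x y → ShareAncestor (network connected) x y
    edge⇒shared xy = index (pair x y)
      , step (arc-index (edge→diag xy (inj₁ refl))) (step (arc-index diag→leaf) here)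
      , step (arc-index (edge→diag xy (inj₂ refl))) (step (arc-index diag→leaf) here)
    shared⇒edge : ShareAncestor (network connected) x y → Edge x y
    shared⇒edge (w , wx , wy) =
      LeafBelow⇒adjacent (LeafBelow-path wx (LeafBelow-leafIndex x)) (LeafBelow-path wy (LeafBelow-leafIndex y)) x≢y

  roots≡edgeCount : (connected : Connected G) → roots (network connected) ≡ edgeCount G
  roots≡edgeCount connected = begin
    countF (λ i → isZero (indegᵛ (element i)))                  ≡⟨ countF-cong (isZero-indeg ∘ element) ⟩
    countF (isRootᴮ ∘ Sum.map₂ (remQuot n) ∘ splitAt n)         ≡⟨ countF-splitAt n (isRootᴮ ∘ Sum.map₂ (remQuot n)) ⟩
    countF {n} (λ _ → false) + countF (isRootᴮ ∘ inj₂ ∘ remQuot n)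
      ≡⟨ cong (_+ countF (isRootᴮ ∘ inj₂ ∘ remQuot n)) (countF-none {n} (λ _ → false) λ _ → refl) ⟩
    countF (isRootᴮ ∘ inj₂ ∘ remQuot n)                        ≡⟨ countF-remQuot n (isRootᴮ ∘ inj₂) ⟩
    sum (upperDegree G)                                        ≡⟨ edgeCount≡sum-upperDegree G ⟨
    edgeCount G                                                ∎
    where open ≡-Reasoning

proposition4p1 : ∀ (n : ℕ) (G : Graph n) → n ≥ 2 → Connected G →
    Σ (Network n) λ N → Represents N G × roots N ≡ edgeCount G
proposition4p1 n G n≥2 connected = network connected , represents connected , roots≡edgeCount connected
  where open Construction G (connected⇒neighbour n≥2 connected)
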